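{- Let $\beta=(\beta_1,\dots,\beta_m)$ be a weak composition of $n$ and $1\le i\le m-1$. The map $t_i:W_\beta\to W_{s_i.\beta}$ is a bijection and satisfies $\mathrm{Des}(t_i(w))=\mathrm{Des}(w)$ for all $w\in W_\beta$; in particular $\mathrm{maj}(t_i(w))=\mathrm{maj}(w)$.
   Context: $W_\beta$ is the set of words of length $n$ with exactly $\beta_j$ copies of letter $j$ for each $j$; $s_i.\beta=(\beta_1,\dots,\beta_{i+1},\beta_i,\dots,\beta_m)$ (entries $i,i+1$ swapped). $\mathrm{Des}(w)=\{1\le p\le n-1: w_p>w_{p+1}\}$ and $\mathrm{maj}(w)=\sum_{p\in\mathrm{Des}(w)}p$. The map $t_i$: given $w\in W_\beta$, underline every pair of consecutive letters of the form $(i+1)\,i$; then overline every maximal contiguous run of non-underlined letters all lying in $\{i,i+1\}$ (each such run has the form $i^a(i+1)^b$ with $a,b\ge0$); $t_i(w)$ is obtained by replacing each overlined run $i^a(i+1)^b$ with $i^b(i+1)^a$. -}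

module Defs where

open import Data.Nat using (ℕ; zero; suc; _+_; _<ᵇ_)
open import Data.Bool using (Bool; true; false; _∧_; _∨_; if_then_else_; not)
open import Data.Fin using (Fin; toℕ; inject₁) renaming (suc to fsuc)
open import Data.Fin.Properties using (_≟_)
open import Data.List using (List; []; _∷_; _++_; replicate; length)
open import Data.Nat.ListAction using (sum)
open import Data.Vec using (Vec; lookup; _[_]≔_)
open import Data.Product using (_×_; _,_)
open import Relation.Nullary.Decidable using (⌊_⌋)
open import Relation.Binary.PropositionalEquality using (_≡_)

-- Letters of the alphabet {1,…,m} are encoded as Fin m (letter j+1 ↦ j).
-- Words are lists of letters.

count : ∀ {m} → Fin m → List (Fin m) → ℕ
count j [] = 0
count j (x ∷ w) = (if ⌊ x ≟ j ⌋ then 1 else 0) + count j w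

InW : ∀ {m} → ℕ → Vec ℕ m → List (Fin m) → Set
InW {m} n β w = (length w ≡ n) × (∀ (j : Fin m) → count j w ≡ lookup β j)

WeakComposition : ∀ {m} → ℕ → Vec ℕ m → Set
WeakComposition n β = Data.Vec.sum β ≡ n
  where import Data.Vec

-- For m = suc k, the index i with 1 ≤ i ≤ m-1 is given as i : Fin k;
-- the letter "i" is  inject₁ i  and the letter "i+1" is  fsuc i.
lo hi : ∀ {k} → Fin k → Fin (suc k)
lo i = inject₁ i
hi i = fsuc i

swapβ : ∀ {k} → Fin k → Vec ℕ (suc k) → Vec ℕ (suc k)
swapβ i β = (β [ lo i ]≔ lookup β (hi i)) [ hi i ]≔ lookup β (lo i)

-- Step 1: underline every consecutive pair (i+1) i.
-- (Such pairs cannot overlap, so a left-to-right scan finds all of them.)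
underline : ∀ {k} → Fin k → List (Fin (suc k)) → List (Fin (suc k) × Bool)
underline i [] = []
underline i (x ∷ []) = (x , false) ∷ []
underline i (x ∷ y ∷ rest) =
  if ⌊ x ≟ hi i ⌋ ∧ ⌊ y ≟ lo i ⌋
  then (x , true) ∷ (y , true) ∷ underline i rest
  else (x , false) ∷ underline i (y ∷ rest)

-- Step 2: scan maximal runs of non-underlined letters in {i, i+1}.
-- The current run is recorded by (a , b) = (#i , #(i+1)) in it; a run
-- i^a (i+1)^b is replaced by i^b (i+1)^a.
flush : ∀ {k} → Fin k → ℕ → ℕ → List (Fin (suc k))
flush i a b = replicate b (lo i) ++ replicate a (hi i)

scan : ∀ {k} → Fin k → ℕ → ℕ → List (Fin (suc k) × Bool) → List (Fin (suc k))
scan i a b [] = flush i a b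
scan i a b ((x , true) ∷ rest) = flush i a b ++ (x ∷ scan i 0 0 rest)
scan i a b ((x , false) ∷ rest) =
  if ⌊ x ≟ lo i ⌋ then scan i (suc a) b rest
  else if ⌊ x ≟ hi i ⌋ then scan i a (suc b) rest
  else flush i a b ++ (x ∷ scan i 0 0 rest)

t : ∀ {k} → Fin k → List (Fin (suc k)) → List (Fin (suc k))
t i w = scan i 0 0 (underline i w)

desFrom : ∀ {m} → ℕ → List (Fin m) → List ℕ
desFrom p [] = []
desFrom p (x ∷ []) = []
desFrom p (x ∷ y ∷ rest) =
  if toℕ y <ᵇ toℕ x then p ∷ desFrom (suc p) (y ∷ rest)
  else desFrom (suc p) (y ∷ rest)

Des : ∀ {m} → List (Fin m) → List ℕ
Des w = desFrom 1 w

maj : ∀ {m} → List (Fin m) → ℕ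
maj w = sum (Des w)

-- Cut a word at its underlined pairs (i+1) i and at its letters outside {i, i+1}: what
-- remains are exactly the overlined runs i^a (i+1)^b, and t_i only swaps the exponents of
-- each run.  Hence t_i is an involution, and it moves letters by the transposition (i i+1),
-- which exchanges the multiplicities β_i and β_{i+1}.  Descents are unaffected because a
-- run has no descent inside it, and a neighbour of the run compares in the same way with
-- i as with i+1: on the left it is not i+1, on the right it is not i.
module Submission where

open import Defs
open import Data.Bool using (true; false; if_then_else_)
open import Data.Empty using (⊥-elim)
open import Data.Fin using (Fin; toℕ) renaming (zero to fzero)
open import Data.Fin.Properties using (_≟_; toℕ-inject₁; toℕ-injective)
open import Data.Fin.Permutation.Components using (transpose)
open import Data.List using (List; []; _∷_; _++_; replicate; length; map)
open import Data.List.Properties using (++-assoc; ++-identityʳ; map-++; map-replicate; length-map)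
open import Data.List.Relation.Binary.Permutation.Propositional
  using (_↭_; swap; ↭-refl; ↭-trans; ↭-reflexive)
import Data.List.Relation.Binary.Permutation.Propositional.Properties as ↭
open import Data.Nat using (ℕ; zero; suc; _+_; _<ᵇ_)
open import Data.Nat.ListAction using (sum)
open import Data.Nat.ListAction.Properties using (sum-↭)
open import Data.Nat.Properties using (+-comm; +-suc; +-identityʳ; 1+n≢n)
open import Data.Product using (_×_; _,_; Σ-syntax)
open import Data.Unit using (⊤)
open import Data.Vec using (Vec; lookup; _[_]≔_)
open import Data.Vec.Properties using (lookup∘update; lookup∘update′)
open import Function using (_∘_)
open import Function.Bundles using (mk⇔)
open import Relation.Nullary.Decidable using (Dec; ⌊_⌋; yes; no; isYes≗does; dec-true; dec-false; does-⇔)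
open import Relation.Binary.PropositionalEquality
open ≡-Reasoning

<ᵇ-suc-left : ∀ n m → m ≢ suc n → (n <ᵇ m) ≡ (suc n <ᵇ m)
<ᵇ-suc-left n       zero          _  = refl
<ᵇ-suc-left zero    (suc zero)    ne = ⊥-elim (ne refl)
<ᵇ-suc-left zero    (suc (suc m)) _  = refl
<ᵇ-suc-left (suc n) (suc m)       ne = <ᵇ-suc-left n m (ne ∘ cong suc)

<ᵇ-suc-right : ∀ m n → m ≢ n → (m <ᵇ n) ≡ (m <ᵇ suc n)
<ᵇ-suc-right zero    zero    ne = ⊥-elim (ne refl)
<ᵇ-suc-right zero    (suc n) _  = refl
<ᵇ-suc-right (suc m) zero    _  = refl
<ᵇ-suc-right (suc m) (suc n) ne = <ᵇ-suc-right m n (ne ∘ cong suc)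

⌊≟⌋-refl : ∀ {n} (x : Fin n) → ⌊ x ≟ x ⌋ ≡ true
⌊≟⌋-refl x = trans (isYes≗does (x ≟ x)) (dec-true (x ≟ x) refl)

⌊≟⌋-≢ : ∀ {n} {x y : Fin n} → x ≢ y → ⌊ x ≟ y ⌋ ≡ false
⌊≟⌋-≢ {x = x} {y} x≢y = trans (isYes≗does (x ≟ y)) (dec-false (x ≟ y) x≢y)

HeadNot : {A : Set} → A → List A → Set
HeadNot x []      = ⊤
HeadNot x (y ∷ _) = y ≢ x

indicator : ∀ {m} → Fin m → Fin m → ℕ
indicator j x = if ⌊ x ≟ j ⌋ then 1 else 0

count-as-sum : ∀ {m} (j : Fin m) xs → count j xs ≡ sum (map (indicator j) xs)
count-as-sum j []       = refl
count-as-sum j (x ∷ xs) = cong (_ +_) (count-as-sum j xs)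

count-↭ : ∀ {m} (j : Fin m) {xs ys} → xs ↭ ys → count j xs ≡ count j ys
count-↭ j {xs} {ys} p = begin
  count j xs                  ≡⟨ count-as-sum j xs ⟩
  sum (map (indicator j) xs)  ≡⟨ sum-↭ (↭.map⁺ (indicator j) p) ⟩
  sum (map (indicator j) ys)  ≡⟨ count-as-sum j ys ⟨
  count j ys                  ∎

count-map-involutive : ∀ {m} (g : Fin m → Fin m) → (∀ x → g (g x) ≡ x) →
                       ∀ j xs → count j (map g xs) ≡ count (g j) xs
count-map-involutive g g∘g j []       = refl
count-map-involutive g g∘g j (x ∷ xs) =
  cong₂ (λ b n → (if b then 1 else 0) + n) gx≟j≡x≟gj (count-map-involutive g g∘g j xs)
  where
  gx≡j⇔x≡gj = mk⇔ (λ e → trans (sym (g∘g x)) (cong g e)) (λ e → trans (cong g e) (g∘g j))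
  gx≟j≡x≟gj : ⌊ g x ≟ j ⌋ ≡ ⌊ x ≟ g j ⌋
  gx≟j≡x≟gj = trans (isYes≗does (g x ≟ j))
                    (trans (does-⇔ gx≡j⇔x≡gj (g x ≟ j) (x ≟ g j)) (sym (isYes≗does (x ≟ g j))))

lookup-swap : ∀ {A : Set} {n} {a b : Fin n} → a ≢ b → (β : Vec A n) (j : Fin n) →
              lookup ((β [ a ]≔ lookup β b) [ b ]≔ lookup β a) j ≡ lookup β (transpose a b j)
lookup-swap {a = a} {b} a≢b β j with j ≟ a
... | yes refl = trans (lookup∘update′ a≢b (β [ a ]≔ lookup β b) (lookup β a))
                       (lookup∘update a β (lookup β b))
... | no j≢a with j ≟ b
...   | yes refl = lookup∘update b (β [ a ]≔ lookup β b) (lookup β a)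
...   | no j≢b   = trans (lookup∘update′ j≢b (β [ a ]≔ lookup β b) (lookup β a))
                         (lookup∘update′ j≢a β (lookup β b))

desFrom-∷∷-cong : ∀ {m} p (x x′ y y′ : Fin m) u u′ →
                  (toℕ y <ᵇ toℕ x) ≡ (toℕ y′ <ᵇ toℕ x′) →
                  desFrom (suc p) (y ∷ u) ≡ desFrom (suc p) (y′ ∷ u′) →
                  desFrom p (x ∷ y ∷ u) ≡ desFrom p (x′ ∷ y′ ∷ u′)
desFrom-∷∷-cong p _ _ _ _ _ _ = cong₂ (λ b D → if b then p ∷ D else D)

desFrom-fzero∷ : ∀ {m} p (w : List (Fin (suc m))) → desFrom p (fzero ∷ w) ≡ desFrom (suc p) w
desFrom-fzero∷ p []      = refl
desFrom-fzero∷ p (y ∷ w) = refl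

module _ {k : ℕ} (i : Fin k) where

  private
    F : Set
    F = Fin (suc k)
    L H : F
    L = lo i
    H = hi i

  L≢H : L ≢ H
  L≢H e = 1+n≢n (sym (trans (sym (toℕ-inject₁ i)) (cong toℕ e)))

  H≢L : H ≢ L
  H≢L = L≢H ∘ sym

  -- The runs i^a (i+1)^b are the overlined runs of the paper; the separators are its
  -- underlined pairs and its letters outside {i, i+1}.
  runWord : ℕ → ℕ → List F
  runWord a b = replicate a L ++ replicate b H

  data Separator : Set where
    underlinedPair : Separator
    letter         : (x : F) → x ≢ L → x ≢ H → Separator

  separator : Separator → List F
  separator underlinedPair   = H ∷ L ∷ []
  separator (letter x _ _)   = x ∷ []

  data Runs : Set where
    final : ℕ → ℕ → Runs
    run   : ℕ → ℕ → Separator → Runs → Runs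

  word : Runs → List F
  word (final a b)   = runWord a b
  word (run a b s f) = runWord a b ++ separator s ++ word f

  swapRuns : Runs → Runs
  swapRuns (final a b)   = final b a
  swapRuns (run a b s f) = run b a s (swapRuns f)

  swapRuns-involutive : ∀ f → swapRuns (swapRuns f) ≡ f
  swapRuns-involutive (final a b)   = refl
  swapRuns-involutive (run a b s f) = cong (run a b s) (swapRuns-involutive f)

  headNot-replicate-H : ∀ b w → HeadNot L w → HeadNot L (replicate b H ++ w)
  headNot-replicate-H zero    w hw = hw
  headNot-replicate-H (suc b) w _  = H≢L

  headNot-separator : ∀ s w → HeadNot L (separator s ++ w)
  headNot-separator underlinedPair   w = H≢L
  headNot-separator (letter x x≢L _) w = x≢L

  underline-∷ : ∀ x w → x ≢ H → underline i (x ∷ w) ≡ (x , false) ∷ underline i w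
  underline-∷ x []      _   = refl
  underline-∷ x (y ∷ w) x≢H rewrite ⌊≟⌋-≢ x≢H = refl

  underline-H∷ : ∀ w → HeadNot L w → underline i (H ∷ w) ≡ (H , false) ∷ underline i w
  underline-H∷ []      _   = refl
  underline-H∷ (y ∷ w) y≢L rewrite ⌊≟⌋-refl H | ⌊≟⌋-≢ y≢L = refl

  underline-HL : ∀ w → underline i (H ∷ L ∷ w) ≡ (H , true) ∷ (L , true) ∷ underline i w
  underline-HL w rewrite ⌊≟⌋-refl H | ⌊≟⌋-refl L = refl

  scan-L : ∀ a b r → scan i a b ((L , false) ∷ r) ≡ scan i (suc a) b r
  scan-L a b r rewrite ⌊≟⌋-refl L = refl

  scan-H : ∀ a b r → scan i a b ((H , false) ∷ r) ≡ scan i a (suc b) r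
  scan-H a b r rewrite ⌊≟⌋-≢ H≢L | ⌊≟⌋-refl H = refl

  scan-letter : ∀ a b x r → x ≢ L → x ≢ H → scan i a b ((x , false) ∷ r) ≡ flush i a b ++ x ∷ scan i 0 0 r
  scan-letter a b x r x≢L x≢H rewrite ⌊≟⌋-≢ x≢L | ⌊≟⌋-≢ x≢H = refl

  tAcc : ℕ → ℕ → List F → List F
  tAcc a b w = scan i a b (underline i w)

  tAcc-L : ∀ a b w → tAcc a b (L ∷ w) ≡ tAcc (suc a) b w
  tAcc-L a b w rewrite underline-∷ L w L≢H = scan-L a b (underline i w)

  tAcc-H : ∀ a b w → HeadNot L w → tAcc a b (H ∷ w) ≡ tAcc a (suc b) w
  tAcc-H a b w hw rewrite underline-H∷ w hw = scan-H a b (underline i w)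

  tAcc-replicate-L : ∀ a c d w → tAcc c d (replicate a L ++ w) ≡ tAcc (a + c) d w
  tAcc-replicate-L zero    c d w = refl
  tAcc-replicate-L (suc a) c d w = begin
    tAcc c d (L ∷ replicate a L ++ w)   ≡⟨ tAcc-L c d (replicate a L ++ w) ⟩
    tAcc (suc c) d (replicate a L ++ w) ≡⟨ tAcc-replicate-L a (suc c) d w ⟩
    tAcc (a + suc c) d w                ≡⟨ cong (λ n → tAcc n d w) (+-suc a c) ⟩
    tAcc (suc a + c) d w                ∎

  tAcc-replicate-H : ∀ b c d w → HeadNot L w → tAcc c d (replicate b H ++ w) ≡ tAcc c (b + d) w
  tAcc-replicate-H zero    c d w hw = refl
  tAcc-replicate-H (suc b) c d w hw = begin
    tAcc c d (H ∷ replicate b H ++ w)   ≡⟨ tAcc-H c d _ (headNot-replicate-H b w hw) ⟩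
    tAcc c (suc d) (replicate b H ++ w) ≡⟨ tAcc-replicate-H b c (suc d) w hw ⟩
    tAcc c (b + suc d) w                ≡⟨ cong (λ n → tAcc c n w) (+-suc b d) ⟩
    tAcc c (suc b + d) w                ∎

  tAcc-runWord : ∀ a b w → HeadNot L w → tAcc 0 0 (runWord a b ++ w) ≡ tAcc a b w
  tAcc-runWord a b w hw = begin
    tAcc 0 0 (runWord a b ++ w)                    ≡⟨ cong (tAcc 0 0) (++-assoc (replicate a L) _ w) ⟩
    tAcc 0 0 (replicate a L ++ replicate b H ++ w) ≡⟨ tAcc-replicate-L a 0 0 _ ⟩
    tAcc (a + 0) 0 (replicate b H ++ w)            ≡⟨ tAcc-replicate-H b (a + 0) 0 w hw ⟩
    tAcc (a + 0) (b + 0) w                         ≡⟨ cong₂ (λ a b → tAcc a b w) (+-identityʳ a) (+-identityʳ b) ⟩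
    tAcc a b w                                     ∎

  tAcc-separator : ∀ a b s w → tAcc a b (separator s ++ w) ≡ runWord b a ++ separator s ++ tAcc 0 0 w
  tAcc-separator a b underlinedPair w rewrite underline-HL w = refl
  tAcc-separator a b (letter x x≢L x≢H) w rewrite underline-∷ x w x≢H =
    scan-letter a b x (underline i w) x≢L x≢H

  t-word : ∀ f → t i (word f) ≡ word (swapRuns f)
  t-word (final a b) = begin
    tAcc 0 0 (runWord a b)       ≡⟨ cong (tAcc 0 0) (++-identityʳ (runWord a b)) ⟨
    tAcc 0 0 (runWord a b ++ []) ≡⟨ tAcc-runWord a b [] _ ⟩
    runWord b a                  ∎
  t-word (run a b s f) = begin
    tAcc 0 0 (runWord a b ++ separator s ++ word f) ≡⟨ tAcc-runWord a b _ (headNot-separator s (word f)) ⟩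
    tAcc a b (separator s ++ word f)                ≡⟨ tAcc-separator a b s (word f) ⟩
    runWord b a ++ separator s ++ t i (word f)      ≡⟨ cong (λ v → runWord b a ++ separator s ++ v) (t-word f) ⟩
    runWord b a ++ separator s ++ word (swapRuns f) ∎

  Factorisation : List F → Set
  Factorisation w = Σ[ f ∈ Runs ] word f ≡ w

  prepend-L : ∀ {w} → Factorisation w → Factorisation (L ∷ w)
  prepend-L (final a b   , refl) = final (suc a) b , refl
  prepend-L (run a b s f , refl) = run (suc a) b s f , refl

  prepend-H : ∀ {w} → Factorisation w → Factorisation (H ∷ w)
  prepend-H (final zero b      , refl) = final 0 (suc b) , refl
  prepend-H (final (suc a) b   , refl) = run 0 0 underlinedPair (final a b) , refl
  prepend-H (run zero b s f    , refl) = run 0 (suc b) s f , refl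
  prepend-H (run (suc a) b s f , refl) = run 0 0 underlinedPair (run a b s f) , refl

  prepend : ∀ x {w} → Factorisation w → Factorisation (x ∷ w)
  prepend x fw with x ≟ L | x ≟ H
  ... | yes refl | _        = prepend-L fw
  ... | no _     | yes refl = prepend-H fw
  prepend x (f , refl) | no x≢L | no x≢H = run 0 0 (letter x x≢L x≢H) f , refl

  factorise : ∀ w → Factorisation w
  factorise []      = final 0 0 , refl
  factorise (x ∷ w) = prepend x (factorise w)

  t-involutive : ∀ w → t i (t i w) ≡ w
  t-involutive w with factorise w
  ... | f , refl = begin
    t i (t i (word f))           ≡⟨ cong (t i) (t-word f) ⟩
    t i (word (swapRuns f))      ≡⟨ t-word (swapRuns f) ⟩
    word (swapRuns (swapRuns f)) ≡⟨ cong word (swapRuns-involutive f) ⟩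
    word f                       ∎

  σ : F → F
  σ = transpose L H

  σ-L : σ L ≡ H
  σ-L rewrite dec-true (L ≟ L) refl = refl

  σ-H : σ H ≡ L
  σ-H rewrite dec-false (H ≟ L) H≢L | dec-true (H ≟ H) refl = refl

  σ-fixes : ∀ x → x ≢ L → x ≢ H → σ x ≡ x
  σ-fixes x x≢L x≢H rewrite dec-false (x ≟ L) x≢L | dec-false (x ≟ H) x≢H = refl

  σ-involutive : ∀ x → σ (σ x) ≡ x
  σ-involutive x = by-cases (x ≟ L) (x ≟ H)
    where
    by-cases : Dec (x ≡ L) → Dec (x ≡ H) → σ (σ x) ≡ x
    by-cases (yes refl) _          = trans (cong σ σ-L) σ-H
    by-cases (no _)     (yes refl) = trans (cong σ σ-H) σ-L
    by-cases (no x≢L)   (no x≢H)   = trans (cong σ (σ-fixes x x≢L x≢H)) (σ-fixes x x≢L x≢H)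

  runWord-swap-↭ : ∀ a b → runWord b a ↭ map σ (runWord a b)
  runWord-swap-↭ a b = ↭-trans (↭.++-comm (replicate b L) (replicate a H)) (↭-reflexive (sym σ-runWord))
    where
    σ-runWord : map σ (runWord a b) ≡ replicate a H ++ replicate b L
    σ-runWord rewrite map-++ σ (replicate a L) (replicate b H)
                    | map-replicate σ a L | map-replicate σ b H | σ-L | σ-H = refl

  separator-↭ : ∀ s → separator s ↭ map σ (separator s)
  separator-↭ underlinedPair rewrite σ-H | σ-L = swap H L ↭-refl
  separator-↭ (letter x x≢L x≢H) rewrite σ-fixes x x≢L x≢H = ↭-refl

  word-swapRuns-↭ : ∀ f → word (swapRuns f) ↭ map σ (word f)
  word-swapRuns-↭ (final a b)   = runWord-swap-↭ a b
  word-swapRuns-↭ (run a b s f) =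
    ↭-trans (↭.++⁺ (runWord-swap-↭ a b) (↭.++⁺ (separator-↭ s) (word-swapRuns-↭ f))) (↭-reflexive (sym σ-word))
    where
    σ-word : map σ (word (run a b s f)) ≡ map σ (runWord a b) ++ map σ (separator s) ++ map σ (word f)
    σ-word = trans (map-++ σ (runWord a b) _) (cong (map σ (runWord a b) ++_) (map-++ σ (separator s) _))

  t-↭ : ∀ w → t i w ↭ map σ w
  t-↭ w with factorise w
  ... | f , refl rewrite t-word f = word-swapRuns-↭ f

  length-t : ∀ w → length (t i w) ≡ length w
  length-t w = trans (↭.↭-length (t-↭ w)) (length-map σ w)

  count-t : ∀ j w → count j (t i w) ≡ count (σ j) w
  count-t j w = trans (count-↭ j (t-↭ w)) (count-map-involutive σ σ-involutive j w)

  lookup-swapβ : ∀ (β : Vec ℕ (suc k)) j → lookup (swapβ i β) j ≡ lookup β (σ j)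
  lookup-swapβ = lookup-swap L≢H

  t-InW : ∀ {n} β w → InW n β w → InW n (swapβ i β) (t i w)
  t-InW β w (|w| , #w) = trans (length-t w) |w| , λ j → begin
    count j (t i w)      ≡⟨ count-t j w ⟩
    count (σ j) w        ≡⟨ #w (σ j) ⟩
    lookup β (σ j)       ≡⟨ lookup-swapβ β j ⟨
    lookup (swapβ i β) j ∎

  t-InW⁻ : ∀ {n} β v → InW n (swapβ i β) v → InW n β (t i v)
  t-InW⁻ β v (|v| , #v) = trans (length-t v) |v| , λ j → begin
    count j (t i v)          ≡⟨ count-t j v ⟩
    count (σ j) v            ≡⟨ #v (σ j) ⟩
    lookup (swapβ i β) (σ j) ≡⟨ lookup-swapβ β (σ j) ⟩
    lookup β (σ (σ j))       ≡⟨ cong (lookup β) (σ-involutive j) ⟩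
    lookup β j               ∎

  L<ᵇ≡H<ᵇ : ∀ z → z ≢ H → (toℕ L <ᵇ toℕ z) ≡ (toℕ H <ᵇ toℕ z)
  L<ᵇ≡H<ᵇ z z≢H rewrite toℕ-inject₁ i = <ᵇ-suc-left (toℕ i) (toℕ z) (z≢H ∘ toℕ-injective)

  <ᵇL≡<ᵇH : ∀ y → y ≢ L → (toℕ y <ᵇ toℕ L) ≡ (toℕ y <ᵇ toℕ H)
  <ᵇL≡<ᵇH y y≢L rewrite toℕ-inject₁ i =
    <ᵇ-suc-right (toℕ y) (toℕ i) (λ e → y≢L (toℕ-injective (trans e (sym (toℕ-inject₁ i)))))

  desFrom-L∷≡H∷ : ∀ p w → HeadNot L w → desFrom p (L ∷ w) ≡ desFrom p (H ∷ w)
  desFrom-L∷≡H∷ p []      _   = refl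
  desFrom-L∷≡H∷ p (y ∷ w) y≢L = desFrom-∷∷-cong p L H y y w w (<ᵇL≡<ᵇH y y≢L) refl

  desFrom-runWord : ∀ z → z ≢ H → ∀ p a b w → HeadNot L w →
                    desFrom p (z ∷ runWord a b ++ w) ≡ desFrom p (z ∷ replicate (a + b) H ++ w)
  desFrom-runWord z z≢H p zero    b w hw = refl
  desFrom-runWord z z≢H p (suc a) b w hw =
    desFrom-∷∷-cong p z z L H (runWord a b ++ w) (replicate (a + b) H ++ w) (L<ᵇ≡H<ᵇ z z≢H) (begin
      desFrom (suc p) (L ∷ runWord a b ++ w)         ≡⟨ desFrom-runWord L L≢H (suc p) a b w hw ⟩
      desFrom (suc p) (L ∷ replicate (a + b) H ++ w) ≡⟨ desFrom-L∷≡H∷ (suc p) _ (headNot-replicate-H (a + b) w hw) ⟩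
      desFrom (suc p) (H ∷ replicate (a + b) H ++ w) ∎)

  desFrom-runWord-swap : ∀ z → z ≢ H → ∀ p a b w → HeadNot L w →
                         desFrom p (z ∷ runWord b a ++ w) ≡ desFrom p (z ∷ runWord a b ++ w)
  desFrom-runWord-swap z z≢H p a b w hw = begin
    desFrom p (z ∷ runWord b a ++ w)         ≡⟨ desFrom-runWord z z≢H p b a w hw ⟩
    desFrom p (z ∷ replicate (b + a) H ++ w) ≡⟨ cong (λ n → desFrom p (z ∷ replicate n H ++ w)) (+-comm b a) ⟩
    desFrom p (z ∷ replicate (a + b) H ++ w) ≡⟨ desFrom-runWord z z≢H p a b w hw ⟨
    desFrom p (z ∷ runWord a b ++ w)         ∎

  desFrom-++-cong : ∀ (z : F) p (u v v′ : List F) → (∀ q y → desFrom q (y ∷ v) ≡ desFrom q (y ∷ v′)) →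
                    desFrom p (z ∷ u ++ v) ≡ desFrom p (z ∷ u ++ v′)
  desFrom-++-cong z p []      v v′ v≈v′ = v≈v′ p z
  desFrom-++-cong z p (x ∷ u) v v′ v≈v′ =
    desFrom-∷∷-cong p z z x x (u ++ v) (u ++ v′) refl (desFrom-++-cong x (suc p) u v v′ v≈v′)

  desFrom-separator-cong : ∀ s (u u′ : List F) → (∀ z → z ≢ H → ∀ p → desFrom p (z ∷ u) ≡ desFrom p (z ∷ u′)) →
                           ∀ q y → desFrom q (y ∷ separator s ++ u) ≡ desFrom q (y ∷ separator s ++ u′)
  desFrom-separator-cong underlinedPair   u u′ u≈u′ q y =
    desFrom-∷∷-cong q y y H H (L ∷ u) (L ∷ u′) refl (desFrom-∷∷-cong (suc q) H H L L u u′ refl (u≈u′ L L≢H _))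
  desFrom-separator-cong (letter x _ x≢H) u u′ u≈u′ q y = desFrom-∷∷-cong q y y x x u u′ refl (u≈u′ x x≢H _)

  desFrom-swapRuns : ∀ f z → z ≢ H → ∀ p → desFrom p (z ∷ word (swapRuns f)) ≡ desFrom p (z ∷ word f)
  desFrom-swapRuns (final a b) z z≢H p = begin
    desFrom p (z ∷ runWord b a)       ≡⟨ cong (λ u → desFrom p (z ∷ u)) (++-identityʳ (runWord b a)) ⟨
    desFrom p (z ∷ runWord b a ++ []) ≡⟨ desFrom-runWord-swap z z≢H p a b [] _ ⟩
    desFrom p (z ∷ runWord a b ++ []) ≡⟨ cong (λ u → desFrom p (z ∷ u)) (++-identityʳ (runWord a b)) ⟩
    desFrom p (z ∷ runWord a b)       ∎
  desFrom-swapRuns (run a b s f) z z≢H p = begin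
    desFrom p (z ∷ runWord b a ++ separator s ++ word (swapRuns f))
      ≡⟨ desFrom-runWord-swap z z≢H p a b _ (headNot-separator s _) ⟩
    desFrom p (z ∷ runWord a b ++ separator s ++ word (swapRuns f))
      ≡⟨ desFrom-++-cong z p (runWord a b) (separator s ++ word (swapRuns f)) (separator s ++ word f)
           (desFrom-separator-cong s (word (swapRuns f)) (word f) (desFrom-swapRuns f)) ⟩
    desFrom p (z ∷ runWord a b ++ separator s ++ word f)
      ∎

  -- Prefixing the least letter fzero adds no descent, and gives every run a left neighbour other than i+1.
  Des-t : ∀ w → Des (t i w) ≡ Des w
  Des-t w with factorise w
  ... | f , refl = begin
    desFrom 1 (t i (word f))              ≡⟨ cong (desFrom 1) (t-word f) ⟩
    desFrom 1 (word (swapRuns f))         ≡⟨ desFrom-fzero∷ 0 (word (swapRuns f)) ⟨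
    desFrom 0 (fzero ∷ word (swapRuns f)) ≡⟨ desFrom-swapRuns f fzero (λ ()) 0 ⟩
    desFrom 0 (fzero ∷ word f)            ≡⟨ desFrom-fzero∷ 0 (word f) ⟩
    desFrom 1 (word f)                    ∎

proposition3p7 : ∀ {k n : ℕ} (β : Vec ℕ (suc k)) → WeakComposition n β → (i : Fin k) →
    ((w : List (Fin (suc k))) → InW n β w → InW n (swapβ i β) (t i w))
    × ((w w′ : List (Fin (suc k))) → InW n β w → InW n β w′ → t i w ≡ t i w′ → w ≡ w′)
    × ((v : List (Fin (suc k))) → InW n (swapβ i β) v → Σ[ w ∈ List (Fin (suc k)) ] (InW n β w × t i w ≡ v))
    × ((w : List (Fin (suc k))) → InW n β w → (Des (t i w) ≡ Des w) × (maj (t i w) ≡ maj w))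
proposition3p7 β _ i =
    t-InW i β
  , (λ w w′ _ _ tw≡tw′ → begin
      w             ≡⟨ t-involutive i w ⟨
      t i (t i w)   ≡⟨ cong (t i) tw≡tw′ ⟩
      t i (t i w′)  ≡⟨ t-involutive i w′ ⟩
      w′            ∎)
  , (λ v v∈W → t i v , t-InW⁻ i β v v∈W , t-involutive i v)
  , (λ w _ → Des-t i w , cong sum (Des-t i w))
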